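{- Let $\mathbf{A}=\langle A,\vee,1\rangle$ be a distributive nearlattice. Then the following are equivalent: (1) $\mathbf{A}$ is quasicomplemented; (2) for each $a\in A$ there exists $b\in A$ such that $a^{\top}\cap b^{\top}=\{1\}$ and $a\vee b=1$.
   Context: A distributive nearlattice is a join-semilattice $\langle A,\vee,1\rangle$ with greatest element $1$ in which every principal filter $[a)=\{x\in A\colon a\le x\}$ is a bounded distributive lattice. For $a\in A$, $a^{\top}=\{x\in A\colon x\vee a=1\}$ and $a^{\top\top}=\{y\in A\colon y\vee x=1\text{ for all }x\in a^{\top}\}$. $\mathbf{A}$ is quasicomplemented if for each $a\in A$ there exists $b\in A$ with $a^{\top\top}=b^{\top}$. -}

module Defs where

open import Level using (Level; suc)
open import Data.Product using (Σ; _×_; ∃-syntax)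
open import Relation.Binary.PropositionalEquality using (_≡_)
open import Function.Bundles using (_⇔_)

-- A distributive nearlattice: a join-semilattice ⟨A,∨,1⟩ with greatest
-- element 1 such that every principal filter [a) is a bounded distributive
-- lattice.  [a) is bounded by a and 1 and its join is ∨; the lattice meet of
-- [a) is given by `meet a x y`, specified (as the greatest lower bound within
-- [a)) only for x , y ∈ [a).
record DistributiveNearlattice (ℓ : Level) : Set (suc ℓ) where
  infixl 6 _∨_
  infix 4 _≤_
  field
    Carrier : Set ℓ
    _∨_     : Carrier → Carrier → Carrier
    𝟏       : Carrier
    ∨-assoc : ∀ x y z → (x ∨ y) ∨ z ≡ x ∨ (y ∨ z)
    ∨-comm  : ∀ x y → x ∨ y ≡ y ∨ x
    ∨-idem  : ∀ x → x ∨ x ≡ x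

  _≤_ : Carrier → Carrier → Set ℓ
  x ≤ y = x ∨ y ≡ y

  field
    𝟏-top   : ∀ x → x ≤ 𝟏
    meet    : Carrier → Carrier → Carrier → Carrier
    meet-≥a : ∀ a x y → a ≤ x → a ≤ y → a ≤ meet a x y
    meet-≤ˡ : ∀ a x y → a ≤ x → a ≤ y → meet a x y ≤ x
    meet-≤ʳ : ∀ a x y → a ≤ x → a ≤ y → meet a x y ≤ y
    meet-glb : ∀ a x y z → a ≤ x → a ≤ y → a ≤ z → z ≤ x → z ≤ y → z ≤ meet a x y
    meet-distrib : ∀ a x y z → a ≤ x → a ≤ y → a ≤ z →
                   meet a x (y ∨ z) ≡ meet a x y ∨ meet a x z

module _ {ℓ : Level} (A : DistributiveNearlattice ℓ) where
  open DistributiveNearlattice A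

  _^⊤ : Carrier → Carrier → Set ℓ
  (a ^⊤) x = x ∨ a ≡ 𝟏

  _^⊤⊤ : Carrier → Carrier → Set ℓ
  (a ^⊤⊤) y = ∀ x → (a ^⊤) x → y ∨ x ≡ 𝟏

  Quasicomplemented : Set ℓ
  Quasicomplemented = ∀ a → ∃[ b ] (∀ x → ((a ^⊤⊤) x ⇔ (b ^⊤) x))

  Condition2 : Set ℓ
  Condition2 = ∀ a → ∃[ b ] ((∀ x → (((a ^⊤) x × (b ^⊤) x) ⇔ (x ≡ 𝟏))) × (a ∨ b ≡ 𝟏))

module Submission where

-- Both directions only use that each a^⊤ is an up-set containing 1.  If
-- a^⊤⊤ = b^⊤, then a ∈ a^⊤⊤ gives a ∨ b = 1, and an element of
-- a^⊤ ∩ a^⊤⊤ is orthogonal to itself, hence equal to 1.  Conversely, if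
-- a ∨ b = 1 then b ∈ a^⊤, so a^⊤⊤ ⊆ b^⊤; and for y ∈ b^⊤, x ∈ a^⊤ the join
-- y ∨ x lies in a^⊤ ∩ b^⊤ = {1}, so b^⊤ ⊆ a^⊤⊤.

open import Defs
open import Level using (Level)
open import Data.Product using (_,_; _×_)
open import Function.Bundles using (_⇔_; mk⇔; Equivalence)
open import Relation.Binary.PropositionalEquality using (_≡_; refl; sym; trans; cong; module ≡-Reasoning)

module _ {ℓ : Level} (A : DistributiveNearlattice ℓ) where
  open DistributiveNearlattice A
  open Equivalence using (to; from)

  ⊤[_] ⊤⊤[_] : Carrier → Carrier → Set ℓ
  ⊤[_]  = _^⊤ A
  ⊤⊤[_] = _^⊤⊤ A

  𝟏-absorbˡ : ∀ x → 𝟏 ∨ x ≡ 𝟏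
  𝟏-absorbˡ x = trans (∨-comm 𝟏 x) (𝟏-top x)

  ^⊤-sym : ∀ {a x} → ⊤[ a ] x → ⊤[ x ] a
  ^⊤-sym {a} {x} x∨a≡𝟏 = trans (∨-comm a x) x∨a≡𝟏

  𝟏∈^⊤ : ∀ a → ⊤[ a ] 𝟏
  𝟏∈^⊤ = 𝟏-absorbˡ

  ^⊤-upwardˡ : ∀ {a} x y → ⊤[ a ] x → ⊤[ a ] (x ∨ y)
  ^⊤-upwardˡ {a} x y x∨a≡𝟏 = begin
    (x ∨ y) ∨ a  ≡⟨ ∨-assoc x y a ⟩
    x ∨ (y ∨ a)  ≡⟨ cong (x ∨_) (∨-comm y a) ⟩
    x ∨ (a ∨ y)  ≡⟨ ∨-assoc x a y ⟨
    (x ∨ a) ∨ y  ≡⟨ cong (_∨ y) x∨a≡𝟏 ⟩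
    𝟏 ∨ y        ≡⟨ 𝟏-absorbˡ y ⟩
    𝟏            ∎
    where open ≡-Reasoning

  ^⊤-upwardʳ : ∀ {a} x y → ⊤[ a ] y → ⊤[ a ] (x ∨ y)
  ^⊤-upwardʳ {a} x y y∈a^⊤ = trans (cong (_∨ a) (∨-comm x y)) (^⊤-upwardˡ y x y∈a^⊤)

  ∈^⊤⊤-self : ∀ a → ⊤⊤[ a ] a
  ∈^⊤⊤-self a x = ^⊤-sym

  ^⊤∩^⊤⊤≡𝟏 : ∀ {a x} → ⊤[ a ] x → ⊤⊤[ a ] x → x ≡ 𝟏
  ^⊤∩^⊤⊤≡𝟏 {x = x} x∈a^⊤ x∈a^⊤⊤ = trans (sym (∨-idem x)) (x∈a^⊤⊤ x x∈a^⊤)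

  ^⊤⊤⊆^⊤ : ∀ {a b y} → ⊤[ a ] b → ⊤⊤[ a ] y → ⊤[ b ] y
  ^⊤⊤⊆^⊤ {b = b} b∈a^⊤ y∈a^⊤⊤ = y∈a^⊤⊤ b b∈a^⊤

  ^⊤⊆^⊤⊤ : ∀ {a b y} → (∀ x → ⊤[ a ] x → ⊤[ b ] x → x ≡ 𝟏) →
           ⊤[ b ] y → ⊤⊤[ a ] y
  ^⊤⊆^⊤⊤ {y = y} disjoint y∈b^⊤ x x∈a^⊤ =
    disjoint (y ∨ x) (^⊤-upwardʳ y x x∈a^⊤) (^⊤-upwardˡ y x y∈b^⊤)

  quasicomplemented⇒condition2 : Quasicomplemented A → Condition2 A
  quasicomplemented⇒condition2 quasi a with quasi a
  ... | b , a^⊤⊤⇔b^⊤ = b , (λ x → mk⇔ (∩≡𝟏 x) (𝟏∈∩ x)) , a∨b≡𝟏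
    where
    a∨b≡𝟏 : a ∨ b ≡ 𝟏
    a∨b≡𝟏 = to (a^⊤⊤⇔b^⊤ a) (∈^⊤⊤-self a)

    ∩≡𝟏 : ∀ x → ⊤[ a ] x × ⊤[ b ] x → x ≡ 𝟏
    ∩≡𝟏 x (x∈a^⊤ , x∈b^⊤) = ^⊤∩^⊤⊤≡𝟏 x∈a^⊤ (from (a^⊤⊤⇔b^⊤ x) x∈b^⊤)

    𝟏∈∩ : ∀ x → x ≡ 𝟏 → ⊤[ a ] x × ⊤[ b ] x
    𝟏∈∩ _ refl = 𝟏∈^⊤ a , 𝟏∈^⊤ b

  condition2⇒quasicomplemented : Condition2 A → Quasicomplemented A
  condition2⇒quasicomplemented cond a with cond a
  ... | b , ∩⇔𝟏 , a∨b≡𝟏 =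
    b , λ y → mk⇔ (^⊤⊤⊆^⊤ (^⊤-sym a∨b≡𝟏)) (^⊤⊆^⊤⊤ disjoint)
    where
    disjoint : ∀ x → ⊤[ a ] x → ⊤[ b ] x → x ≡ 𝟏
    disjoint x x∈a^⊤ x∈b^⊤ = to (∩⇔𝟏 x) (x∈a^⊤ , x∈b^⊤)

theorem3p4 : {ℓ : Level} (A : DistributiveNearlattice ℓ) →
    Quasicomplemented A ⇔ Condition2 A
theorem3p4 A = mk⇔ (quasicomplemented⇒condition2 A) (condition2⇒quasicomplemented A)
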